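{- Let $f:\{0,1\}^n\to\{0,1\}$ with $F:=f^{ -1}(1)\ne\emptyset$, $N:=|F|$, and $\delta:=1/36$. Define $g_f:\{0,1\}^n\to\{0,1\}$ by $g_f(a)=1$ iff $\Pr_{x\sim F}[f(a\oplus x)=1]\ge 1/2$ (with $x$ uniform on $F$). For $a\in\{0,1\}^n$ let $\mathsf{W}(a)=\{x\in F: f(a\oplus x)\ne f(a)\}$, and let $H=\{a\in\{0,1\}^n:|\mathsf{W}(a)|>\delta N\}$. If $|H|\le\delta N$, then for every $a\in\{0,1\}^n$, $\Pr_{x\sim F}[g_f(a)=f(a\oplus x)]\ge 1-4\delta$.
   Context: $\oplus$ denotes coordinatewise XOR; $x\sim F$ denotes a uniformly random element of $F$. -}

module Defs where

import Agda.Primitive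
open import Data.Bool using (Bool; true; false; _xor_; if_then_else_)
open import Data.Nat using (ℕ; zero; suc; _*_; _≤?_)
open import Data.List using (List; []; _∷_; map; concatMap; filter; length)
open import Data.Vec using (Vec; []; _∷_; zipWith)
open import Data.Product using (_×_)
open import Relation.Nullary using (Dec; yes; no; ¬_)
open import Relation.Nullary.Decidable using (_×-dec_)
open import Relation.Nullary.Decidable using (⌊_⌋; ¬?)
open import Relation.Binary.PropositionalEquality using (_≢_)
open import Relation.Unary using (Pred; Decidable)
open import Relation.Binary.PropositionalEquality using (_≡_)
import Data.Bool.Properties as BP

Cube : ℕ → Set
Cube n = Vec Bool n

_⊕_ : ∀ {n} → Cube n → Cube n → Cube n
_⊕_ = zipWith _xor_

allCube : (n : ℕ) → List (Cube n)
allCube zero = [] ∷ []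
allCube (suc n) = concatMap (λ v → (false ∷ v) ∷ (true ∷ v) ∷ []) (allCube n)

count : ∀ {n} {P : Pred (Cube n) Agda.Primitive.lzero} → Decidable P → ℕ
count {n} P? = length (filter P? (allCube n))

inF : ∀ {n} → (Cube n → Bool) → Cube n → Set
inF f x = f x ≡ true

inF? : ∀ {n} (f : Cube n → Bool) → Decidable (inF f)
inF? f x = f x BP.≟ true

sizeF : ∀ {n} → (Cube n → Bool) → ℕ
sizeF f = count (inF? f)

-- #{x ∈ F : f(a ⊕ x) = 1}, i.e. N · Pr_{x∼F}[f(a⊕x)=1]
hits : ∀ {n} → (Cube n → Bool) → Cube n → ℕ
hits f a = count (λ x → inF? f x ×-dec (f (a ⊕ x) BP.≟ true))

-- g_f(a) = 1 iff Pr_{x∼F}[f(a⊕x)=1] ≥ 1/2, i.e. 2·hits ≥ N.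
g : ∀ {n} → (Cube n → Bool) → Cube n → Bool
g f a = ⌊ sizeF f ≤? 2 * hits f a ⌋

sizeW : ∀ {n} → (Cube n → Bool) → Cube n → ℕ
sizeW f a = count (λ x → inF? f x ×-dec ¬? (f (a ⊕ x) BP.≟ f a))

-- |H| where H = {a : |W(a)| > δN}, δ = 1/36, i.e. 36·|W(a)| > N.
sizeH : ∀ {n} → (Cube n → Bool) → ℕ
sizeH f = count (λ a → suc (sizeF f) ≤? 36 * sizeW f a)

-- #{x ∈ F : g_f(a) = f(a⊕x)}, i.e. N · Pr_{x∼F}[g_f(a) = f(a⊕x)]
agree : ∀ {n} → (Cube n → Bool) → Cube n → ℕ
agree f a = count (λ x → inF? f x ×-dec (g f a BP.≟ f (a ⊕ x)))

-- Fix a and split F into hits (f(a ⊕ x) = 1) and misses (f(a ⊕ x) = 0), so N = h + k; g_f(a)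
-- picks the larger class, hence the agreement count is max(h, k). For a hit x and a miss y the
-- value f(a ⊕ x ⊕ y) disagrees with f(a ⊕ x) or with f(a ⊕ y), i.e. y ∈ W(a ⊕ x) or x ∈ W(a ⊕ y),
-- so h·k ≤ ∑_{x ∈ F} |W(a ⊕ x)|. Since x ↦ a ⊕ x is a bijection of the cube, at most |H| ≤ N/36
-- of these terms are larger than N/36, and each is at most N; thus h·k ≤ N²/18, which forces
-- min(h, k) ≤ N/9.

module Submission where

open import Defs
open import Data.Bool using (Bool; true; false; not; _∧_; _xor_)
open import Data.Bool.Properties using (xor-assoc; xor-comm) renaming (_≟_ to _≟ᵇ_)
open import Data.List using (List; []; _∷_; map; filter; length; concatMap)
open import Data.Nat
open import Data.Nat.ListAction using (sum)
open import Data.Nat.Properties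
open import Data.Nat.Tactic.RingSolver using (solve-∀)
open import Data.Product using (∃)
open import Data.Sum using (inj₁; inj₂)
open import Data.Vec using ([]; _∷_)
open import Data.Vec.Properties using (zipWith-assoc; zipWith-comm)
open import Function using (_∘_)
open import Level using (Level; 0ℓ)
open import Relation.Nullary using (Dec; does; ¬?; yes; no; contradiction)
open import Relation.Nullary.Decidable using (from-no; isYes)
open import Relation.Unary using (Pred; Decidable)
open import Relation.Binary.PropositionalEquality

private
  variable
    ℓ ℓ′ : Level
    A B : Set ℓ′

𝟙 : Bool → ℕ
𝟙 true  = 1
𝟙 false = 0

∑ : List A → (A → ℕ) → ℕ
∑ xs p = sum (map p xs)

∑-cong : ∀ (xs : List A) {p q : A → ℕ} → (∀ x → p x ≡ q x) → ∑ xs p ≡ ∑ xs q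
∑-cong []       eq = refl
∑-cong (x ∷ xs) eq = cong₂ _+_ (eq x) (∑-cong xs eq)

∑-mono-≤ : ∀ (xs : List A) {p q : A → ℕ} → (∀ x → p x ≤ q x) → ∑ xs p ≤ ∑ xs q
∑-mono-≤ []       le = z≤n
∑-mono-≤ (x ∷ xs) le = +-mono-≤ (le x) (∑-mono-≤ xs le)

∑-zero : ∀ (xs : List A) → ∑ xs (λ _ → 0) ≡ 0
∑-zero []       = refl
∑-zero (x ∷ xs) = ∑-zero xs

∑-distrib-+ : ∀ (xs : List A) (p q : A → ℕ) → ∑ xs (λ x → p x + q x) ≡ ∑ xs p + ∑ xs q
∑-distrib-+ []       p q = refl
∑-distrib-+ (x ∷ xs) p q = trans (cong (p x + q x +_) (∑-distrib-+ xs p q))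
                                 (+-+-assoc-swap (p x) (q x) (∑ xs p) (∑ xs q))
  where
  +-+-assoc-swap : ∀ i j k l → i + j + (k + l) ≡ i + k + (j + l)
  +-+-assoc-swap = solve-∀

∑-*ˡ : ∀ (xs : List A) (c : ℕ) (p : A → ℕ) → c * ∑ xs p ≡ ∑ xs (λ x → c * p x)
∑-*ˡ []       c p = *-zeroʳ c
∑-*ˡ (x ∷ xs) c p = trans (*-distribˡ-+ c (p x) (∑ xs p)) (cong (c * p x +_) (∑-*ˡ xs c p))

∑-*ʳ : ∀ (xs : List A) (c : ℕ) (p : A → ℕ) → ∑ xs p * c ≡ ∑ xs (λ x → p x * c)
∑-*ʳ []       c p = refl
∑-*ʳ (x ∷ xs) c p = trans (*-distribʳ-+ c (p x) (∑ xs p)) (cong (p x * c +_) (∑-*ʳ xs c p))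

∑-comm : ∀ (xs : List A) (ys : List B) (p : A → B → ℕ) →
         ∑ xs (λ x → ∑ ys (p x)) ≡ ∑ ys (λ y → ∑ xs (λ x → p x y))
∑-comm []       ys p = sym (∑-zero ys)
∑-comm (x ∷ xs) ys p = trans (cong (∑ ys (p x) +_) (∑-comm xs ys p))
                             (sym (∑-distrib-+ ys (p x) _))

∑-*-∑ : ∀ (xs : List A) (ys : List B) (p : A → ℕ) (q : B → ℕ) →
        ∑ xs p * ∑ ys q ≡ ∑ xs (λ x → ∑ ys (λ y → p x * q y))
∑-*-∑ xs ys p q = trans (∑-*ʳ xs (∑ ys q) p) (∑-cong xs (λ x → ∑-*ˡ ys (p x) q))

∑∑-+-transpose : ∀ (xs : List A) (ys : List B) (p : A → B → ℕ) (q : B → A → ℕ) →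
  ∑ xs (λ x → ∑ ys (λ y → p x y + q y x)) ≡ ∑ xs (λ x → ∑ ys (p x)) + ∑ ys (λ y → ∑ xs (q y))
∑∑-+-transpose xs ys p q = begin
  ∑ xs (λ x → ∑ ys (λ y → p x y + q y x))                    ≡⟨ ∑-cong xs (λ x → ∑-distrib-+ ys (p x) (λ y → q y x)) ⟩
  ∑ xs (λ x → ∑ ys (p x) + ∑ ys (λ y → q y x))               ≡⟨ ∑-distrib-+ xs _ _ ⟩
  ∑ xs (λ x → ∑ ys (p x)) + ∑ xs (λ x → ∑ ys (λ y → q y x))  ≡⟨ cong (∑ xs (λ x → ∑ ys (p x)) +_) (∑-comm xs ys (λ x y → q y x)) ⟩
  ∑ xs (λ x → ∑ ys (p x)) + ∑ ys (λ y → ∑ xs (q y))          ∎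
  where open ≡-Reasoning

length-filter≡∑ : ∀ {P : Pred A ℓ} (P? : Decidable P) (xs : List A) →
                  length (filter P? xs) ≡ ∑ xs (𝟙 ∘ does ∘ P?)
length-filter≡∑ P? []       = refl
length-filter≡∑ P? (x ∷ xs) with does (P? x)
... | true  = cong suc (length-filter≡∑ P? xs)
... | false = length-filter≡∑ P? xs

∑ᶜ : ∀ {n} → (Cube n → ℕ) → ℕ
∑ᶜ {n} = ∑ (allCube n)

count≡∑ᶜ : ∀ {n} {P : Pred (Cube n) 0ℓ} (P? : Decidable P) (χ : Cube n → Bool) →
           (∀ x → does (P? x) ≡ χ x) → count P? ≡ ∑ᶜ (𝟙 ∘ χ)
count≡∑ᶜ {n} P? χ eq = trans (length-filter≡∑ P? (allCube n)) (∑-cong (allCube n) (cong 𝟙 ∘ eq))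

∑ᶜ-suc : ∀ {n} (p : Cube (suc n) → ℕ) → ∑ᶜ p ≡ ∑ᶜ (p ∘ (false ∷_)) + ∑ᶜ (p ∘ (true ∷_))
∑ᶜ-suc {n} p = go (allCube n)
  where
  go : ∀ xs → ∑ (concatMap (λ v → (false ∷ v) ∷ (true ∷ v) ∷ []) xs) p
            ≡ ∑ xs (p ∘ (false ∷_)) + ∑ xs (p ∘ (true ∷_))
  go []       = refl
  go (v ∷ xs) = trans (cong (λ s → p (false ∷ v) + (p (true ∷ v) + s)) (go xs))
                      (interleave (p (false ∷ v)) (p (true ∷ v)) _ _)
    where
    interleave : ∀ i j k l → i + (j + (k + l)) ≡ i + k + (j + l)
    interleave = solve-∀

∑ᶜ-⊕ : ∀ {n} (a : Cube n) (p : Cube n → ℕ) → ∑ᶜ (λ x → p (a ⊕ x)) ≡ ∑ᶜ p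
∑ᶜ-⊕ []          p = refl
∑ᶜ-⊕ (false ∷ a) p = begin
  ∑ᶜ (λ x → p ((false ∷ a) ⊕ x))                              ≡⟨ ∑ᶜ-suc (λ x → p ((false ∷ a) ⊕ x)) ⟩
  ∑ᶜ (λ x → p (false ∷ a ⊕ x)) + ∑ᶜ (λ x → p (true ∷ a ⊕ x)) ≡⟨ cong₂ _+_ (∑ᶜ-⊕ a _) (∑ᶜ-⊕ a _) ⟩
  ∑ᶜ (p ∘ (false ∷_)) + ∑ᶜ (p ∘ (true ∷_))                    ≡⟨ ∑ᶜ-suc p ⟨
  ∑ᶜ p                                                        ∎
  where open ≡-Reasoning
∑ᶜ-⊕ (true ∷ a)  p = begin
  ∑ᶜ (λ x → p ((true ∷ a) ⊕ x))                               ≡⟨ ∑ᶜ-suc (λ x → p ((true ∷ a) ⊕ x)) ⟩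
  ∑ᶜ (λ x → p (true ∷ a ⊕ x)) + ∑ᶜ (λ x → p (false ∷ a ⊕ x)) ≡⟨ cong₂ _+_ (∑ᶜ-⊕ a _) (∑ᶜ-⊕ a _) ⟩
  ∑ᶜ (p ∘ (true ∷_)) + ∑ᶜ (p ∘ (false ∷_))                    ≡⟨ +-comm (∑ᶜ (p ∘ (true ∷_))) _ ⟩
  ∑ᶜ (p ∘ (false ∷_)) + ∑ᶜ (p ∘ (true ∷_))                    ≡⟨ ∑ᶜ-suc p ⟨
  ∑ᶜ p                                                        ∎
  where open ≡-Reasoning

⊕-assoc : ∀ {n} (x y z : Cube n) → (x ⊕ y) ⊕ z ≡ x ⊕ (y ⊕ z)
⊕-assoc = zipWith-assoc xor-assoc

⊕-comm : ∀ {n} (x y : Cube n) → x ⊕ y ≡ y ⊕ x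
⊕-comm = zipWith-comm xor-comm

⊕-swapʳ : ∀ {n} (a x y : Cube n) → (a ⊕ x) ⊕ y ≡ (a ⊕ y) ⊕ x
⊕-swapʳ a x y = trans (⊕-assoc a x y) (trans (cong (a ⊕_) (⊕-comm x y)) (sym (⊕-assoc a y x)))

𝟙-split : ∀ u v → 𝟙 u ≡ 𝟙 (u ∧ v) + 𝟙 (u ∧ not v)
𝟙-split false v     = refl
𝟙-split true  true  = refl
𝟙-split true  false = refl

𝟙-∧-≤ : ∀ u v → 𝟙 (u ∧ v) ≤ 𝟙 u
𝟙-∧-≤ false v     = z≤n
𝟙-∧-≤ true  false = z≤n
𝟙-∧-≤ true  true  = ≤-refl

does-≟-true : ∀ b → does (b ≟ᵇ true) ≡ b
does-≟-true false = refl
does-≟-true true  = refl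

does-true-≟ : ∀ b → does (true ≟ᵇ b) ≡ b
does-true-≟ false = refl
does-true-≟ true  = refl

does-false-≟ : ∀ b → does (false ≟ᵇ b) ≡ not b
does-false-≟ false = refl
does-false-≟ true  = refl

does-≢ : ∀ b c → does (¬? (b ≟ᵇ c)) ≡ b xor c
does-≢ false false = refl
does-≢ false true  = refl
does-≢ true  false = refl
does-≢ true  true  = refl

-- Read u, v, u′, v′, c as [x ∈ F], f(a ⊕ x), [y ∈ F], f(a ⊕ y), f(a ⊕ x ⊕ y).
pair-bound : ∀ u v u′ v′ c →
  𝟙 (u ∧ v) * 𝟙 (u′ ∧ not v′) ≤ 𝟙 (u ∧ v) * 𝟙 (u′ ∧ (c xor v)) + 𝟙 (u′ ∧ not v′) * 𝟙 (u ∧ (c xor v′))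
pair-bound false _     _     _     _     = z≤n
pair-bound true  false _     _     _     = z≤n
pair-bound true  true  false _     _     = z≤n
pair-bound true  true  true  true  _     = z≤n
pair-bound true  true  true  false true  = ≤-refl
pair-bound true  true  true  false false = ≤-refl

heavy-or-light : ∀ k {w N} (heavy? : Dec (N < k * w)) → w ≤ N → k * w ≤ N + k * N * 𝟙 (does heavy?)
heavy-or-light k {w} {N} (yes _)    w≤N = begin
  k * w            ≤⟨ *-monoʳ-≤ k w≤N ⟩
  k * N            ≡⟨ *-identityʳ (k * N) ⟨
  k * N * 1        ≤⟨ m≤n+m _ N ⟩
  N + k * N * 1    ∎
  where open ≤-Reasoning
heavy-or-light k {w} {N} (no N≮kw) w≤N = ≤-trans (≮⇒≥ N≮kw) (m≤m+n N _)

weighted-heavy-or-light : ∀ k u {w N} (heavy? : Dec (N < k * w)) → w ≤ N →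
  k * (𝟙 u * w) ≤ 𝟙 u * N + k * N * 𝟙 (does heavy?)
weighted-heavy-or-light k false         _      _   = ≤-trans (≤-reflexive (*-zeroʳ k)) z≤n
weighted-heavy-or-light k true  {w} {N} heavy? w≤N
  rewrite *-identityˡ w | *-identityˡ N = heavy-or-light k heavy? w≤N

m≤n⇒18*m*n≤[m+n]²⇒8*m≤n : ∀ m n → m ≤ n → 18 * (m * n) ≤ (m + n) * (m + n) → 8 * m ≤ n
m≤n⇒18*m*n≤[m+n]²⇒8*m≤n zero      n         _   _     = z≤n
m≤n⇒18*m*n≤[m+n]²⇒8*m≤n m@(suc _) n@(suc _) m≤n bound with 8 * m ≤? n
... | yes 8m≤n = 8m≤n
... | no  8m≰n = contradiction (*-cancelʳ-≤ 18 11 (m * n) (≤-trans bound square≤11mn)) (from-no (18 ≤? 11))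
  where
  open ≤-Reasoning
  n*n≤8mn : n * n ≤ 8 * (m * n)
  n*n≤8mn = ≤-trans (*-monoˡ-≤ n (<⇒≤ (≰⇒> 8m≰n))) (≤-reflexive (*-assoc 8 m n))
  square≤11mn : (m + n) * (m + n) ≤ 11 * (m * n)
  square≤11mn = begin
    (m + n) * (m + n)                   ≡⟨ expand m n ⟩
    m * m + n * n + 2 * (m * n)         ≤⟨ +-monoˡ-≤ _ (+-mono-≤ (*-monoʳ-≤ m m≤n) n*n≤8mn) ⟩
    m * n + 8 * (m * n) + 2 * (m * n)   ≡⟨ collect (m * n) ⟩
    11 * (m * n)                        ∎
    where
    expand : ∀ i j → (i + j) * (i + j) ≡ i * i + j * j + 2 * (i * j)
    expand = solve-∀
    collect : ∀ i → i + 8 * i + 2 * i ≡ 11 * i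
    collect = solve-∀

8*m≤n⇒8*[m+n]≤9*n : ∀ m n → 8 * m ≤ n → 8 * (m + n) ≤ 9 * n
8*m≤n⇒8*[m+n]≤9*n m n 8m≤n = begin
  8 * (m + n)    ≡⟨ *-distribˡ-+ 8 m n ⟩
  8 * m + 8 * n  ≤⟨ +-monoˡ-≤ (8 * n) 8m≤n ⟩
  n + 8 * n      ≡⟨⟩
  9 * n          ∎
  where open ≤-Reasoning

m+n≤2*m⇒n≤m : ∀ m n → m + n ≤ 2 * m → n ≤ m
m+n≤2*m⇒n≤m m n le = +-cancelˡ-≤ m n m (≤-trans le (≤-reflexive (cong (m +_) (+-identityʳ m))))

m+n≰2*m⇒m≤n : ∀ m n → m + n ≰ 2 * m → m ≤ n
m+n≰2*m⇒m≤n m n nle = +-cancelˡ-≤ m m n (≤-trans (≤-reflexive (cong (m +_) (sym (+-identityʳ m)))) (<⇒≤ (≰⇒> nle)))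

18*m*n≤[m+n]²⇒8*[m+n]≤9*[m⊔n] : ∀ m n → 18 * (m * n) ≤ (m + n) * (m + n) → 8 * (m + n) ≤ 9 * (m ⊔ n)
18*m*n≤[m+n]²⇒8*[m+n]≤9*[m⊔n] m n bound with ≤-total m n
... | inj₁ m≤n rewrite m≤n⇒m⊔n≡n m≤n = 8*m≤n⇒8*[m+n]≤9*n m n (m≤n⇒18*m*n≤[m+n]²⇒8*m≤n m n m≤n bound)
... | inj₂ n≤m rewrite m≥n⇒m⊔n≡m n≤m | +-comm m n | *-comm m n = 8*m≤n⇒8*[m+n]≤9*n n m (m≤n⇒18*m*n≤[m+n]²⇒8*m≤n n m n≤m bound)

module _ {n : ℕ} (f : Cube n → Bool) where

  W : Cube n → Cube n → Bool
  W b y = f y ∧ (f (b ⊕ y) xor f b)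

  heavy : Cube n → Bool
  heavy b = does (suc (sizeF f) ≤? 36 * sizeW f b)

  sizeF≡∑ᶜ : sizeF f ≡ ∑ᶜ (𝟙 ∘ f)
  sizeF≡∑ᶜ = count≡∑ᶜ (inF? f) f (does-≟-true ∘ f)

  sizeW≡∑ᶜ : ∀ b → sizeW f b ≡ ∑ᶜ (𝟙 ∘ W b)
  sizeW≡∑ᶜ b = count≡∑ᶜ _ (W b) λ y → cong₂ _∧_ (does-≟-true (f y)) (does-≢ (f (b ⊕ y)) (f b))

  sizeH≡∑ᶜ : sizeH f ≡ ∑ᶜ (𝟙 ∘ heavy)
  sizeH≡∑ᶜ = count≡∑ᶜ _ heavy λ _ → refl

  sizeW≤sizeF : ∀ b → sizeW f b ≤ sizeF f
  sizeW≤sizeF b = begin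
    sizeW f b       ≡⟨ sizeW≡∑ᶜ b ⟩
    ∑ᶜ (𝟙 ∘ W b)    ≤⟨ ∑-mono-≤ (allCube n) (λ y → 𝟙-∧-≤ (f y) _) ⟩
    ∑ᶜ (𝟙 ∘ f)      ≡⟨ sizeF≡∑ᶜ ⟨
    sizeF f         ∎
    where open ≤-Reasoning

  module _ (a : Cube n) where

    hit miss : Cube n → Bool
    hit  x = f x ∧ f (a ⊕ x)
    miss x = f x ∧ not (f (a ⊕ x))

    misses : ℕ
    misses = ∑ᶜ (𝟙 ∘ miss)

    hits≡∑ᶜ : hits f a ≡ ∑ᶜ (𝟙 ∘ hit)
    hits≡∑ᶜ = count≡∑ᶜ _ hit λ x → cong₂ _∧_ (does-≟-true (f x)) (does-≟-true (f (a ⊕ x)))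

    sizeF≡hits+misses : sizeF f ≡ hits f a + misses
    sizeF≡hits+misses = begin
      sizeF f                     ≡⟨ sizeF≡∑ᶜ ⟩
      ∑ᶜ (𝟙 ∘ f)                  ≡⟨ ∑-cong (allCube n) (λ x → 𝟙-split (f x) (f (a ⊕ x))) ⟩
      ∑ᶜ (λ x → 𝟙 (hit x) + 𝟙 (miss x))  ≡⟨ ∑-distrib-+ (allCube n) (𝟙 ∘ hit) (𝟙 ∘ miss) ⟩
      ∑ᶜ (𝟙 ∘ hit) + misses       ≡⟨ cong (_+ misses) hits≡∑ᶜ ⟨
      hits f a + misses           ∎
      where open ≡-Reasoning

    massW : ℕ
    massW = ∑ᶜ λ x → 𝟙 (f x) * sizeW f (a ⊕ x)

    hits*misses≤massW : hits f a * misses ≤ massW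
    hits*misses≤massW = begin
      hits f a * misses                                        ≡⟨ cong (_* misses) hits≡∑ᶜ ⟩
      ∑ᶜ (𝟙 ∘ hit) * misses                                    ≡⟨ ∑-*-∑ C C (𝟙 ∘ hit) (𝟙 ∘ miss) ⟩
      ∑ᶜ (λ x → ∑ᶜ (λ y → 𝟙 (hit x) * 𝟙 (miss y)))            ≤⟨ ∑-mono-≤ C (λ x → ∑-mono-≤ C (hit-miss-pair x)) ⟩
      ∑ᶜ (λ x → ∑ᶜ (λ y → wit hit x y + wit miss y x))        ≡⟨ ∑∑-+-transpose C C (wit hit) (wit miss) ⟩
      ∑ᶜ (λ x → ∑ᶜ (wit hit x)) + ∑ᶜ (λ x → ∑ᶜ (wit miss x))  ≡⟨ cong₂ _+_ (∑-cong C (weight hit)) (∑-cong C (weight miss)) ⟩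
      ∑ᶜ (λ x → 𝟙 (hit x) * w x) + ∑ᶜ (λ x → 𝟙 (miss x) * w x) ≡⟨ ∑-distrib-+ C _ _ ⟨
      ∑ᶜ (λ x → 𝟙 (hit x) * w x + 𝟙 (miss x) * w x)           ≡⟨ ∑-cong C merge ⟩
      massW                                                    ∎
      where
      open ≤-Reasoning
      C : List (Cube n)
      C = allCube n
      w : Cube n → ℕ
      w x = sizeW f (a ⊕ x)
      wit : (Cube n → Bool) → Cube n → Cube n → ℕ
      wit χ x y = 𝟙 (χ x) * 𝟙 (W (a ⊕ x) y)
      hit-miss-pair : ∀ x y → 𝟙 (hit x) * 𝟙 (miss y) ≤ wit hit x y + wit miss y x
      hit-miss-pair x y rewrite ⊕-swapʳ a y x = pair-bound (f x) (f (a ⊕ x)) (f y) (f (a ⊕ y)) (f ((a ⊕ x) ⊕ y))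
      weight : ∀ χ x → ∑ᶜ (wit χ x) ≡ 𝟙 (χ x) * w x
      weight χ x = trans (sym (∑-*ˡ C (𝟙 (χ x)) _)) (cong (𝟙 (χ x) *_) (sym (sizeW≡∑ᶜ (a ⊕ x))))
      merge : ∀ x → 𝟙 (hit x) * w x + 𝟙 (miss x) * w x ≡ 𝟙 (f x) * w x
      merge x = trans (sym (*-distribʳ-+ (w x) (𝟙 (hit x)) _)) (cong (_* w x) (sym (𝟙-split (f x) (f (a ⊕ x)))))

    massW-bound : 36 * massW ≤ sizeF f * sizeF f + 36 * sizeF f * sizeH f
    massW-bound = begin
      36 * massW                                                 ≡⟨ ∑-*ˡ C 36 _ ⟩
      ∑ᶜ (λ x → 36 * (𝟙 (f x) * sizeW f (a ⊕ x)))                ≤⟨ ∑-mono-≤ C light-or-heavy ⟩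
      ∑ᶜ (λ x → 𝟙 (f x) * N + 36 * N * 𝟙 (heavy (a ⊕ x)))       ≡⟨ ∑-distrib-+ C _ _ ⟩
      ∑ᶜ (λ x → 𝟙 (f x) * N) + ∑ᶜ (λ x → 36 * N * 𝟙 (heavy (a ⊕ x)))
                                                                 ≡⟨ cong₂ _+_ (∑-*ʳ C N (𝟙 ∘ f)) (∑-*ˡ C (36 * N) _) ⟨
      ∑ᶜ (𝟙 ∘ f) * N + 36 * N * ∑ᶜ (λ x → 𝟙 (heavy (a ⊕ x)))     ≡⟨ cong₂ (λ s t → s * N + 36 * N * t) sizeF≡∑ᶜ sizeH≡shifted ⟨
      N * N + 36 * N * sizeH f                                   ∎
      where
      open ≤-Reasoning
      C : List (Cube n)
      C = allCube n
      N : ℕ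
      N = sizeF f
      sizeH≡shifted : sizeH f ≡ ∑ᶜ (λ x → 𝟙 (heavy (a ⊕ x)))
      sizeH≡shifted = trans sizeH≡∑ᶜ (sym (∑ᶜ-⊕ a (𝟙 ∘ heavy)))
      light-or-heavy : ∀ x → 36 * (𝟙 (f x) * sizeW f (a ⊕ x)) ≤ 𝟙 (f x) * N + 36 * N * 𝟙 (heavy (a ⊕ x))
      light-or-heavy x = weighted-heavy-or-light 36 (f x) (suc N ≤? 36 * sizeW f (a ⊕ x)) (sizeW≤sizeF (a ⊕ x))

    hits*misses-bound : 36 * sizeH f ≤ sizeF f → 18 * (hits f a * misses) ≤ sizeF f * sizeF f
    hits*misses-bound H-small = *-cancelˡ-≤ 2 (begin
      2 * (18 * (hits f a * misses))  ≡⟨ *-assoc 2 18 (hits f a * misses) ⟨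
      36 * (hits f a * misses)        ≤⟨ *-monoʳ-≤ 36 hits*misses≤massW ⟩
      36 * massW                      ≤⟨ massW-bound ⟩
      N * N + 36 * N * sizeH f        ≡⟨ cong (N * N +_) (rearrange N (sizeH f)) ⟩
      N * N + N * (36 * sizeH f)      ≤⟨ +-monoʳ-≤ (N * N) (*-monoʳ-≤ N H-small) ⟩
      N * N + N * N                   ≡⟨ cong (N * N +_) (+-identityʳ (N * N)) ⟨
      2 * (N * N)                     ∎)
      where
      open ≤-Reasoning
      N : ℕ
      N = sizeF f
      rearrange : ∀ i j → 36 * i * j ≡ i * (36 * j)
      rearrange = solve-∀

    agree≡hits⊔misses : agree f a ≡ hits f a ⊔ misses
    agree≡hits⊔misses = trans (count≡∑ᶜ _ (λ x → f x ∧ does (g f a ≟ᵇ f (a ⊕ x)))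
                                         (λ x → cong (_∧ does (g f a ≟ᵇ f (a ⊕ x))) (does-≟-true (f x))))
                              (by-majority (sizeF f ≤? 2 * hits f a))
      where
      open ≡-Reasoning
      C : List (Cube n)
      C = allCube n
      by-majority : (d : Dec (sizeF f ≤ 2 * hits f a)) →
                    ∑ᶜ (λ x → 𝟙 (f x ∧ does (isYes d ≟ᵇ f (a ⊕ x)))) ≡ hits f a ⊔ misses
      by-majority (yes N≤2h) = begin
        ∑ᶜ (λ x → 𝟙 (f x ∧ does (true ≟ᵇ f (a ⊕ x))))  ≡⟨ ∑-cong C (λ x → cong (𝟙 ∘ (f x ∧_)) (does-true-≟ (f (a ⊕ x)))) ⟩
        ∑ᶜ (𝟙 ∘ hit)                                   ≡⟨ hits≡∑ᶜ ⟨
        hits f a                                       ≡⟨ m≥n⇒m⊔n≡m misses≤hits ⟨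
        hits f a ⊔ misses                              ∎
        where
        misses≤hits : misses ≤ hits f a
        misses≤hits = m+n≤2*m⇒n≤m (hits f a) misses (subst (_≤ 2 * hits f a) sizeF≡hits+misses N≤2h)
      by-majority (no N≰2h) = begin
        ∑ᶜ (λ x → 𝟙 (f x ∧ does (false ≟ᵇ f (a ⊕ x)))) ≡⟨ ∑-cong C (λ x → cong (𝟙 ∘ (f x ∧_)) (does-false-≟ (f (a ⊕ x)))) ⟩
        misses                                         ≡⟨ m≤n⇒m⊔n≡n hits≤misses ⟨
        hits f a ⊔ misses                              ∎
        where
        hits≤misses : hits f a ≤ misses
        hits≤misses = m+n≰2*m⇒m≤n (hits f a) misses (N≰2h ∘ subst (_≤ 2 * hits f a) (sym sizeF≡hits+misses))

lemma3p12 : (n : ℕ) (f : Cube n → Bool) →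
    ∃ (λ x → inF f x) →
    36 * sizeH f ≤ sizeF f →
    (a : Cube n) → 8 * sizeF f ≤ 9 * agree f a
lemma3p12 n f _ H-small a = begin
  8 * sizeF f                  ≡⟨ cong (8 *_) (sizeF≡hits+misses f a) ⟩
  8 * (hits f a + misses f a)  ≤⟨ 18*m*n≤[m+n]²⇒8*[m+n]≤9*[m⊔n] (hits f a) (misses f a) disagreement ⟩
  9 * (hits f a ⊔ misses f a)  ≡⟨ cong (9 *_) (agree≡hits⊔misses f a) ⟨
  9 * agree f a                ∎
  where
  open ≤-Reasoning
  disagreement : 18 * (hits f a * misses f a) ≤ (hits f a + misses f a) * (hits f a + misses f a)
  disagreement = subst (λ N → 18 * (hits f a * misses f a) ≤ N * N) (sizeF≡hits+misses f a)
                       (hits*misses-bound f a H-small)
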